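{- Let $r\ge 2$ and $n\ge r^2+1$ be integers. Then there exist two disjoint independent sets in $H_{n:r}$, each of size $\binom{n}{r+1}+\frac{r-1}{r+1}\binom{r^2}{r}$.
   Context: For positive integers $n,r$ write $[n]=\{1,\dots,n\}$. The Häggkvist–Hell graph $H_{n:r}$ is the graph whose vertices are the ordered pairs $(h,T)$ where $T$ is an $r$-element subset of $[n]$ and $h\in[n]\setminus T$; two vertices $(h_x,T_x)$ and $(h_y,T_y)$ are adjacent iff $h_x\in T_y$, $h_y\in T_x$ and $T_x\cap T_y=\varnothing$. -}

module Defs where

open import Data.Nat using (ℕ)
open import Data.Fin using (Fin)
open import Data.Fin.Subset using (Subset; _∈_; _∉_; _∩_; ∣_∣; Empty)
open import Data.Product using (_×_; _,_)
open import Data.List using (List)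
open import Data.List.Membership.Propositional using () renaming (_∈_ to _∈ₗ_)
open import Data.List.Relation.Unary.Unique.Propositional using (Unique)
open import Relation.Binary.PropositionalEquality using (_≡_)
open import Relation.Nullary using (¬_)

-- The ground set [n] is modelled by Fin n; an r-subset T of [n] by a
-- Subset n with ∣ T ∣ ≡ r.  Candidate vertices are pairs (h , T).
Pair : ℕ → Set
Pair n = Fin n × Subset n

IsVertex : (n r : ℕ) → Fin n × Subset n → Set
IsVertex n r (h , T) = (∣ T ∣ ≡ r) × (h ∉ T)

Adj : {n : ℕ} → Fin n × Subset n → Fin n × Subset n → Set
Adj (hx , Tx) (hy , Ty) = (hx ∈ Ty) × (hy ∈ Tx) × Empty (Tx ∩ Ty)

-- A (finite) set of vertices of H_{n:r}, represented as a duplicate-free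
-- list; its size is its length.
IsVertexSet : (n r : ℕ) → List (Fin n × Subset n) → Set
IsVertexSet n r I = Unique I × (∀ {x} → x ∈ₗ I → IsVertex n r x)

IsIndependent : (n r : ℕ) → List (Fin n × Subset n) → Set
IsIndependent n r I =
  IsVertexSet n r I × (∀ {x y} → x ∈ₗ I → y ∈ₗ I → ¬ Adj x y)

Disjoint : {n : ℕ} → List (Fin n × Subset n) → List (Fin n × Subset n) → Set
Disjoint I J = ∀ {x} → x ∈ₗ I → ¬ (x ∈ₗ J)

module Submission where

-- Write r = k + 1 and n = d + r², the last r² points forming the "core".
-- Call a vertex (h , T)
--   * head-first  if h is one of the first d points and h < min T;
--   * anchored    if T avoids the first d points and contains the last point.
-- Two head-first vertices are never adjacent (h_x ∈ T_y and h_y ∈ T_x would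
-- give h_y < h_x < h_y), a head-first and an anchored vertex neither
-- (the head-first head would lie in the anchored set), and two anchored
-- vertices share the last point.  So any set of such vertices is
-- independent.  The set I consists of all head-first vertices and all
-- anchored vertices inside the core; it is built recursively: the core part
-- is the mirror image of the vertices of H_{r²:r} whose set contains 0, and
-- adding a new smallest point keeps all old vertices and adds the head-first
-- vertices with that point as head, one for every r-subset of the rest.
-- The second set is J = mirror I, where mirror reverses the order of [n];
-- mirror is an automorphism of H_{n:r}, and (for d > 0) no vertex lies in I
-- together with its mirror image.  Counting with Pascal's rule gives
--   |I| + C(r², r+1) = C(n, r+1) + r·C(r²-1, r),
-- and the absorption identity for binomials turns this into the size
-- claimed in the theorem.  The argument only needs r ≥ 1.

open import Level using (Level)
open import Function using (_∘_; id)
open import Data.Bool using (true; false; if_then_else_)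
open import Data.Bool.Properties using (_≟_)
open import Data.Nat using (ℕ; zero; suc; pred; _+_; _*_; _^_; _∸_; _≤_; _<_; z≤n; s≤s)
open import Data.Nat.Properties
  using ( suc-injective; *-zeroʳ; *-distribˡ-+; +-comm; +-cancelʳ-≡; *-cancelˡ-≡
        ; <-asym; <⇒≱; n≮0; ∸-monoʳ-<; n∸n≡0; m≤n⇒∃[o]m+o≡n)
open import Data.Nat.Combinatorics using (_C_; nC1≡n; nCk+nC[k+1]≡[n+1]C[k+1])
open import Data.Nat.Tactic.RingSolver using (solve-∀)
open import Data.Fin using (Fin; zero; suc; toℕ; opposite; fromℕ; inject₁)
open import Data.Fin.Properties
  using (opposite-prop; opposite-involutive; toℕ-injective; toℕ<n; toℕ-fromℕ)
open import Data.Fin.Subset using (Subset; _∈_; ∣_∣; inside; outside; Nonempty)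
open import Data.Fin.Subset.Properties using (x∈p∩q⁺; x∈p∩q⁻)
open import Data.Vec using (Vec; []; _∷_; _∷ʳ_; reverse; lookup; count; here; there)
open import Data.Vec.Properties using (∷-injectiveʳ; reverse-∷; reverse-injective; lookup⇒[]=; []=⇒lookup)
open import Data.Product using (_×_; _,_; ∃; ∃₂; proj₁; proj₂)
open import Data.Sum using (_⊎_; inj₁; inj₂)
open import Data.List using (List; []; _∷_; [_]; _++_; map; length)
open import Data.List.Properties using (length-map; length-++)
open import Data.List.Membership.Propositional using () renaming (_∈_ to _∈ₗ_)
open import Data.List.Membership.Propositional.Properties using (∈-map⁻)
open import Data.List.Relation.Unary.All as All using (All)
open import Data.List.Relation.Unary.All.Properties using (map⁺) renaming (++⁺ to All-++⁺)
open import Data.List.Relation.Unary.AllPairs as AllPairs using ()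
open import Data.List.Relation.Unary.Unique.Propositional using (Unique)
import Data.List.Relation.Unary.Unique.Propositional.Properties as Unique
open import Relation.Nullary using (¬_; does)
open import Relation.Unary using (Pred; Decidable)
open import Relation.Binary.PropositionalEquality
  using (_≡_; refl; sym; trans; cong; cong₂; subst; subst₂; module ≡-Reasoning)

open import Defs

private
  variable
    ℓ : Level
    A B : Set ℓ
    n : ℕ

open ≡-Reasoning

pascal : ∀ n k → suc n C suc k ≡ n C k + n C suc k
pascal n k = sym (nCk+nC[k+1]≡[n+1]C[k+1] n k)

absorption : ∀ n k → suc k * (n C suc k) + k * (n C k) ≡ n * (n C k)
absorption n zero = trans (cong (λ c → 1 * c + 0) (nC1≡n n)) (unit n)
  where
  unit : ∀ n → 1 * n + 0 ≡ n * 1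
  unit = solve-∀
absorption zero (suc k) = cong₂ _+_ (*-zeroʳ (suc (suc k))) (*-zeroʳ (suc k))
absorption (suc n) (suc k) = begin
  suc (suc k) * (suc n C suc (suc k)) + suc k * (suc n C suc k)
    ≡⟨ cong₂ (λ u v → suc (suc k) * u + suc k * v) (pascal n (suc k)) (pascal n k) ⟩
  suc (suc k) * (b + c) + suc k * (a + b)
    ≡⟨ regroup a b c k ⟩
  (suc (suc k) * c + suc k * b) + b + a + (suc k * b + k * a)
    ≡⟨ cong₂ (λ u v → u + b + a + v) (absorption n (suc k)) (absorption n k) ⟩
  n * b + b + a + n * a
    ≡⟨ collect a b n ⟩
  suc n * (a + b)
    ≡⟨ cong (suc n *_) (sym (pascal n k)) ⟩
  suc n * (suc n C suc k) ∎
  where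
  a = n C k
  b = n C suc k
  c = n C suc (suc k)
  regroup : ∀ a b c k → suc (suc k) * (b + c) + suc k * (a + b)
                      ≡ (suc (suc k) * c + suc k * b) + b + a + (suc k * b + k * a)
  regroup = solve-∀
  collect : ∀ a b n → n * b + b + a + n * a ≡ suc n * (a + b)
  collect = solve-∀

-- With m = k² + 2k, absorption gives C(m, k+1) = k·C(m, k), and then a second
-- absorption step expresses C(m, k+2) through C(m, k+1).
core-identity : ∀ {k m} → m ≡ k * k + 2 * k →
  suc (suc k) * (suc k * (m C suc k)) ≡ suc (suc k) * (suc m C suc (suc k)) + k * (suc m C suc k)
core-identity {k} {m} m≡ = +-cancelʳ-≡ (r * b) (suc r * (r * b)) (suc r * (suc m C suc r) + k * (suc m C r)) (begin
  suc r * (r * b) + r * b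
    ≡⟨ expand b k ⟩
  suc r * b + (k * k + 2 * k) * b + b + k * b
    ≡⟨ cong₂ (λ u v → suc r * b + u * b + v + k * b) (sym m≡) b≡k*a ⟩
  suc r * b + m * b + k * a + k * b
    ≡⟨ cong (λ u → suc r * b + u + k * a + k * b) (sym (absorption m r)) ⟩
  suc r * b + (suc r * c + r * b) + k * a + k * b
    ≡⟨ regroup a b c k ⟩
  suc r * (b + c) + k * (a + b) + r * b
    ≡⟨ cong₂ (λ u v → suc r * u + k * v + r * b) (sym (pascal m r)) (sym (pascal m k)) ⟩
  suc r * (suc m C suc r) + k * (suc m C r) + r * b ∎)
  where
  r = suc k
  a = m C k
  b = m C r
  c = m C suc r
  b≡k*a : b ≡ k * a
  b≡k*a = *-cancelˡ-≡ b (k * a) r (+-cancelʳ-≡ (k * a) (r * b) (r * (k * a)) (begin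
    r * b + k * a         ≡⟨ absorption m k ⟩
    m * a                 ≡⟨ cong (_* a) m≡ ⟩
    (k * k + 2 * k) * a   ≡⟨ spread k a ⟩
    r * (k * a) + k * a   ∎))
    where
    spread : ∀ k a → (k * k + 2 * k) * a ≡ suc k * (k * a) + k * a
    spread = solve-∀
  expand : ∀ b k → suc (suc k) * (suc k * b) + suc k * b
                 ≡ suc (suc k) * b + (k * k + 2 * k) * b + b + k * b
  expand = solve-∀
  regroup : ∀ a b c k → suc (suc k) * b + (suc (suc k) * c + suc k * b) + k * a + k * b
                      ≡ suc (suc k) * (b + c) + k * (a + b) + suc k * b
  regroup = solve-∀

unique-++ : (P : A → Set) {xs ys : List A} → Unique xs → Unique ys →
            All P xs → All (¬_ ∘ P) ys → Unique (xs ++ ys)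
unique-++ P xs! ys! Pxs ¬Pys =
  Unique.++⁺ xs! ys! (λ (v∈xs , v∈ys) → All.lookup ¬Pys v∈ys (All.lookup Pxs v∈xs))

all-images : {P : B → Set} (f : A → B) → (∀ x → P (f x)) → ∀ xs → All P (map f xs)
all-images f Pf xs = map⁺ (All.universal Pf xs)

length-map-++ : {C : Set ℓ} (f : A → C) (g : B → C) (xs : List A) (ys : List B) →
                length (map f xs ++ map g ys) ≡ length xs + length ys
length-map-++ f g xs ys = trans (length-++ (map f xs)) (cong₂ _+_ (length-map f xs) (length-map g ys))

lookup-∷ʳ-last : (xs : Vec A n) (x : A) → lookup (xs ∷ʳ x) (fromℕ n) ≡ x
lookup-∷ʳ-last []       x = refl
lookup-∷ʳ-last (y ∷ xs) x = lookup-∷ʳ-last xs x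

lookup-∷ʳ-inject₁ : (xs : Vec A n) (x : A) (i : Fin n) → lookup (xs ∷ʳ x) (inject₁ i) ≡ lookup xs i
lookup-∷ʳ-inject₁ (y ∷ xs) x zero    = refl
lookup-∷ʳ-inject₁ (y ∷ xs) x (suc i) = lookup-∷ʳ-inject₁ xs x i

lookup-reverse : (xs : Vec A n) (i : Fin n) → lookup (reverse xs) (opposite i) ≡ lookup xs i
lookup-reverse (x ∷ xs) zero = begin
  lookup (reverse (x ∷ xs)) (fromℕ _) ≡⟨ cong (λ v → lookup v (fromℕ _)) (reverse-∷ x xs) ⟩
  lookup (reverse xs ∷ʳ x) (fromℕ _)  ≡⟨ lookup-∷ʳ-last (reverse xs) x ⟩
  x                                   ∎
lookup-reverse (x ∷ xs) (suc i) = begin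
  lookup (reverse (x ∷ xs)) (inject₁ (opposite i)) ≡⟨ cong (λ v → lookup v (inject₁ (opposite i))) (reverse-∷ x xs) ⟩
  lookup (reverse xs ∷ʳ x) (inject₁ (opposite i))  ≡⟨ lookup-∷ʳ-inject₁ (reverse xs) x (opposite i) ⟩
  lookup (reverse xs) (opposite i)                 ≡⟨ lookup-reverse xs i ⟩
  lookup xs i                                      ∎

count-∷ʳ : {P : Pred A ℓ} (P? : Decidable P) (xs : Vec A n) (x : A) →
           count P? (xs ∷ʳ x) ≡ count P? (x ∷ xs)
count-∷ʳ P? []       x = refl
count-∷ʳ P? (y ∷ xs) x rewrite count-∷ʳ P? xs x with does (P? x) | does (P? y)
... | true  | true  = refl
... | true  | false = refl
... | false | _     = refl

count-reverse : {P : Pred A ℓ} (P? : Decidable P) (xs : Vec A n) → count P? (reverse xs) ≡ count P? xs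
count-reverse P? []       = refl
count-reverse P? (x ∷ xs) = begin
  count P? (reverse (x ∷ xs)) ≡⟨ cong (count P?) (reverse-∷ x xs) ⟩
  count P? (reverse xs ∷ʳ x)  ≡⟨ count-∷ʳ P? (reverse xs) x ⟩
  count P? (x ∷ reverse xs)   ≡⟨ cong (if does (P? x) then suc else id) (count-reverse P? xs) ⟩
  count P? (x ∷ xs)           ∎

∈-reverse⁺ : {i : Fin n} {T : Subset n} → i ∈ T → opposite i ∈ reverse T
∈-reverse⁺ {i = i} {T} i∈T = lookup⇒[]= (opposite i) (reverse T) (trans (lookup-reverse T i) ([]=⇒lookup i∈T))

∈-reverse⁻ : {j : Fin n} {T : Subset n} → j ∈ reverse T → opposite j ∈ T
∈-reverse⁻ {j = j} {T} j∈T′ = lookup⇒[]= (opposite j) T (begin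
  lookup T (opposite j)                      ≡⟨ lookup-reverse T (opposite j) ⟨
  lookup (reverse T) (opposite (opposite j)) ≡⟨ cong (lookup (reverse T)) (opposite-involutive j) ⟩
  lookup (reverse T) j                       ≡⟨ []=⇒lookup j∈T′ ⟩
  inside                                     ∎)

opposite∈reverse⁻ : {i : Fin n} {T : Subset n} → opposite i ∈ reverse T → i ∈ T
opposite∈reverse⁻ {i = i} {T} p = subst (_∈ T) (opposite-involutive i) (∈-reverse⁻ p)

opposite-< : {i j : Fin n} → toℕ i < toℕ j → toℕ (opposite j) < toℕ (opposite i)
opposite-< {n} {i} {j} i<j = subst₂ _<_ (sym (opposite-prop j)) (sym (opposite-prop i))
  (∸-monoʳ-< {n} {suc (toℕ j)} {suc (toℕ i)} (s≤s i<j) (toℕ<n j))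

IsLast : Fin n → Set
IsLast {n} t = suc (toℕ t) ≡ n

last-unique : {s t : Fin n} → IsLast s → IsLast t → s ≡ t
last-unique s-last t-last = toℕ-injective (suc-injective (trans s-last (sym t-last)))

opposite-last : {t : Fin n} → IsLast t → toℕ (opposite t) ≡ 0
opposite-last {n} {t} t-last = trans (opposite-prop t) (trans (cong (n ∸_) t-last) (n∸n≡0 n))

-- Adding a new smallest point 0 to the ground set.

lift : Pair n → Pair (suc n)
lift (h , T) = suc h , outside ∷ T

liftWith0 : Pair n → Pair (suc n)
liftWith0 (h , T) = suc h , inside ∷ T

apex : Subset n → Pair (suc n)
apex T = zero , outside ∷ T

lift-injective : {x y : Pair n} → lift x ≡ lift y → x ≡ y
lift-injective {x = _ , _} {_ , _} refl = refl

liftWith0-injective : {x y : Pair n} → liftWith0 x ≡ liftWith0 y → x ≡ y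
liftWith0-injective {x = _ , _} {_ , _} refl = refl

apex-injective : {S T : Subset n} → apex S ≡ apex T → S ≡ T
apex-injective refl = refl

lift-vertex : ∀ {k} {x : Pair n} → IsVertex n k x → IsVertex (suc n) k (lift x)
lift-vertex (∣T∣≡k , h∉T) = ∣T∣≡k , λ { (there h∈T) → h∉T h∈T }

liftWith0-vertex : ∀ {k} {x : Pair n} → IsVertex n k x → IsVertex (suc n) (suc k) (liftWith0 x)
liftWith0-vertex (∣T∣≡k , h∉T) = cong suc ∣T∣≡k , λ { (there h∈T) → h∉T h∈T }

apex-vertex : ∀ {k} {T : Subset n} → ∣ T ∣ ≡ k → IsVertex (suc n) k (apex T)
apex-vertex ∣T∣≡k = ∣T∣≡k , λ ()

HeadIsZero : Pair (suc n) → Set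
HeadIsZero (h , _) = h ≡ zero

ContainsZero : Pair (suc n) → Set
ContainsZero (_ , T) = zero ∈ T

subsets : (n k : ℕ) → List (Subset n)
subsets zero    zero    = [ [] ]
subsets zero    (suc k) = []
subsets (suc n) zero    = map (outside ∷_) (subsets n zero)
subsets (suc n) (suc k) = map (inside ∷_) (subsets n k) ++ map (outside ∷_) (subsets n (suc k))

subsets-size : ∀ n k → All (λ T → ∣ T ∣ ≡ k) (subsets n k)
subsets-size zero    zero    = refl All.∷ All.[]
subsets-size zero    (suc k) = All.[]
subsets-size (suc n) zero    = map⁺ (subsets-size n zero)
subsets-size (suc n) (suc k) = All-++⁺ (map⁺ (All.map (cong suc) (subsets-size n k))) (map⁺ (subsets-size n (suc k)))

subsets-unique : ∀ n k → Unique (subsets n k)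
subsets-unique zero    zero    = All.[] AllPairs.∷ AllPairs.[]
subsets-unique zero    (suc k) = AllPairs.[]
subsets-unique (suc n) zero    = Unique.map⁺ ∷-injectiveʳ (subsets-unique n zero)
subsets-unique (suc n) (suc k) =
  unique-++ (λ T → zero ∈ T) (Unique.map⁺ ∷-injectiveʳ (subsets-unique n k)) (Unique.map⁺ ∷-injectiveʳ (subsets-unique n (suc k)))
    (all-images (inside ∷_) (λ _ → here) (subsets n k)) (all-images (outside ∷_) (λ _ ()) (subsets n (suc k)))

subsets-length : ∀ n k → length (subsets n k) ≡ n C k
subsets-length zero    zero    = refl
subsets-length zero    (suc k) = refl
subsets-length (suc n) zero    = trans (length-map (outside ∷_) (subsets n zero)) (subsets-length n zero)
subsets-length (suc n) (suc k) = begin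
  length (map (inside ∷_) (subsets n k) ++ map (outside ∷_) (subsets n (suc k)))
    ≡⟨ length-map-++ (inside ∷_) (outside ∷_) (subsets n k) (subsets n (suc k)) ⟩
  length (subsets n k) + length (subsets n (suc k))
    ≡⟨ cong₂ _+_ (subsets-length n k) (subsets-length n (suc k)) ⟩
  n C k + n C suc k
    ≡⟨ pascal n k ⟨
  suc n C suc k ∎

-- The vertices of H_{n:k}, listed without repetition: a vertex over [n+1]
-- has head 0, or contains 0 in its set, or does not involve 0 at all.

vertices : (n k : ℕ) → List (Pair n)
vertices zero    k       = []
vertices (suc n) zero    = map apex (subsets n zero) ++ map lift (vertices n zero)
vertices (suc n) (suc k) = map apex (subsets n (suc k)) ++ (map liftWith0 (vertices n k) ++ map lift (vertices n (suc k)))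

vertices-vertex : ∀ n k → All (IsVertex n k) (vertices n k)
vertices-vertex zero    k       = All.[]
vertices-vertex (suc n) zero    =
  All-++⁺ (map⁺ (All.map apex-vertex (subsets-size n zero))) (map⁺ (All.map lift-vertex (vertices-vertex n zero)))
vertices-vertex (suc n) (suc k) =
  All-++⁺ (map⁺ (All.map apex-vertex (subsets-size n (suc k))))
    (All-++⁺ (map⁺ (All.map liftWith0-vertex (vertices-vertex n k))) (map⁺ (All.map lift-vertex (vertices-vertex n (suc k)))))

vertices-unique : ∀ n k → Unique (vertices n k)
vertices-unique zero    k       = AllPairs.[]
vertices-unique (suc n) zero    =
  unique-++ HeadIsZero (Unique.map⁺ apex-injective (subsets-unique n zero)) (Unique.map⁺ lift-injective (vertices-unique n zero))
    (all-images apex (λ _ → refl) (subsets n zero)) (all-images lift (λ _ ()) (vertices n zero))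
vertices-unique (suc n) (suc k) =
  unique-++ HeadIsZero (Unique.map⁺ apex-injective (subsets-unique n (suc k)))
    (unique-++ ContainsZero (Unique.map⁺ liftWith0-injective (vertices-unique n k)) (Unique.map⁺ lift-injective (vertices-unique n (suc k)))
      (all-images liftWith0 (λ _ → here) (vertices n k)) (all-images lift (λ _ ()) (vertices n (suc k))))
    (all-images apex (λ _ → refl) (subsets n (suc k)))
    (All-++⁺ (all-images liftWith0 (λ _ ()) (vertices n k)) (all-images lift (λ _ ()) (vertices n (suc k))))

vertices-length : ∀ n k → length (vertices n k) ≡ suc k * (n C suc k)
vertices-length zero    k       = sym (*-zeroʳ (suc k))
vertices-length (suc n) zero    = begin
  length (map apex (subsets n zero) ++ map lift (vertices n zero))
    ≡⟨ length-map-++ apex lift (subsets n zero) (vertices n zero) ⟩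
  length (subsets n zero) + length (vertices n zero)
    ≡⟨ cong₂ _+_ (subsets-length n zero) (vertices-length n zero) ⟩
  1 * (n C 0 + n C 1)
    ≡⟨ cong (1 *_) (pascal n 0) ⟨
  1 * (suc n C 1) ∎
vertices-length (suc n) (suc k) = begin
  length (map apex (subsets n (suc k)) ++ (map liftWith0 (vertices n k) ++ map lift (vertices n (suc k))))
    ≡⟨ length-++ (map apex (subsets n (suc k))) ⟩
  length (map apex (subsets n (suc k))) + length (map liftWith0 (vertices n k) ++ map lift (vertices n (suc k)))
    ≡⟨ cong₂ _+_ (length-map apex (subsets n (suc k))) (length-map-++ liftWith0 lift (vertices n k) (vertices n (suc k))) ⟩
  length (subsets n (suc k)) + (length (vertices n k) + length (vertices n (suc k)))
    ≡⟨ cong₂ (λ u v → u + v) (subsets-length n (suc k)) (cong₂ _+_ (vertices-length n k) (vertices-length n (suc k))) ⟩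
  b + (suc k * b + suc (suc k) * c)
    ≡⟨ collect b c k ⟩
  suc (suc k) * (b + c)
    ≡⟨ cong (suc (suc k) *_) (pascal n (suc k)) ⟨
  suc (suc k) * (suc n C suc (suc k)) ∎
  where
  b = n C suc k
  c = n C suc (suc k)
  collect : ∀ b c k → b + (suc k * b + suc (suc k) * c) ≡ suc (suc k) * (b + c)
  collect = solve-∀

mirror : Pair n → Pair n
mirror (h , T) = opposite h , reverse T

mirror-injective : {x y : Pair n} → mirror x ≡ mirror y → x ≡ y
mirror-injective {x = h , S} {h′ , T} e = cong₂ _,_
  (trans (sym (opposite-involutive h)) (trans (cong (opposite ∘ proj₁) e) (opposite-involutive h′)))
  (reverse-injective (cong proj₂ e))

mirror-vertex : ∀ {r} {x : Pair n} → IsVertex n r x → IsVertex n r (mirror x)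
mirror-vertex {x = h , T} (∣T∣≡r , h∉T) = trans (count-reverse (_≟ inside) T) ∣T∣≡r , h∉T ∘ opposite∈reverse⁻

mirror-adj : {x y : Pair n} → Adj (mirror x) (mirror y) → Adj x y
mirror-adj {x = hx , Tx} {hy , Ty} (hx′∈Ty′ , hy′∈Tx′ , Tx′∩Ty′-empty) =
  opposite∈reverse⁻ hx′∈Ty′ , opposite∈reverse⁻ hy′∈Tx′ , λ (t , t∈Tx∩Ty) →
    let (t∈Tx , t∈Ty) = x∈p∩q⁻ Tx Ty t∈Tx∩Ty
    in Tx′∩Ty′-empty (opposite t , x∈p∩q⁺ (∈-reverse⁺ t∈Tx , ∈-reverse⁺ t∈Ty))

mirror-independent : ∀ {r} {I : List (Pair n)} → IsIndependent n r I → IsIndependent n r (map mirror I)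
mirror-independent {n} {r} {I} ((I! , I-vertex) , I-independent) =
  (Unique.map⁺ mirror-injective I! , image-vertex) , image-independent
  where
  image-vertex : ∀ {x} → x ∈ₗ map mirror I → IsVertex n r x
  image-vertex x∈ with ∈-map⁻ mirror x∈
  ... | x₀ , x₀∈I , refl = mirror-vertex (I-vertex x₀∈I)
  image-independent : ∀ {x y} → x ∈ₗ map mirror I → y ∈ₗ map mirror I → ¬ Adj x y
  image-independent x∈ y∈ adj with ∈-map⁻ mirror x∈ | ∈-map⁻ mirror y∈
  ... | x₀ , x₀∈I , refl | y₀ , y₀∈I , refl = I-independent x₀∈I y₀∈I (mirror-adj adj)

HeadFirst : ℕ → Pair n → Set
HeadFirst d (h , T) = toℕ h < d × (∀ {t} → t ∈ T → toℕ h < toℕ t) × Nonempty T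

Anchored : ℕ → Pair n → Set
Anchored d (h , T) = (∀ {t} → t ∈ T → d ≤ toℕ t) × ∃ λ ℓ → ℓ ∈ T × IsLast ℓ

Class : ℕ → Pair n → Set
Class d x = HeadFirst d x ⊎ Anchored d x

class-independent : ∀ {d} {x y : Pair n} → Class d x → Class d y → ¬ Adj x y
class-independent (inj₁ (_ , hx<Tx , _)) (inj₁ (_ , hy<Ty , _)) (hx∈Ty , hy∈Tx , _) =
  <-asym (hx<Tx hy∈Tx) (hy<Ty hx∈Ty)
class-independent (inj₁ (hx<d , _ , _)) (inj₂ (Ty≥d , _)) (hx∈Ty , _ , _) = <⇒≱ hx<d (Ty≥d hx∈Ty)
class-independent (inj₂ (Tx≥d , _)) (inj₁ (hy<d , _ , _)) (_ , hy∈Tx , _) = <⇒≱ hy<d (Tx≥d hy∈Tx)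
class-independent {y = _ , Ty} (inj₂ (_ , ℓ , ℓ∈Tx , ℓ-last)) (inj₂ (_ , ℓ′ , ℓ′∈Ty , ℓ′-last)) (_ , _ , Tx∩Ty-empty) =
  Tx∩Ty-empty (ℓ , x∈p∩q⁺ (ℓ∈Tx , subst (_∈ Ty) (last-unique ℓ′-last ℓ-last) ℓ′∈Ty))

-- For d > 0 a vertex and its mirror image never both belong to the class:
-- the mirror of an anchored set contains the point 0, which neither a
-- head-first set (its head would precede 0) nor an anchored set may contain.
class-mirror-disjoint : ∀ {d} {x : Pair n} → 0 < d → Class d x → ¬ Class d (mirror x)
class-mirror-disjoint _ (inj₁ (_ , h<T , t , t∈T)) (inj₁ (_ , h′<T′ , _)) =
  <-asym (opposite-< (h<T t∈T)) (h′<T′ (∈-reverse⁺ t∈T))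
class-mirror-disjoint {x = h , _} _ (inj₁ (_ , h<T , _)) (inj₂ (_ , ℓ , ℓ∈T′ , ℓ-last)) =
  n≮0 (subst (toℕ h <_) (opposite-last ℓ-last) (h<T (∈-reverse⁻ ℓ∈T′)))
class-mirror-disjoint {x = h , _} _ (inj₂ (_ , ℓ , ℓ∈T , ℓ-last)) (inj₁ (_ , h′<T′ , _)) =
  n≮0 (subst (toℕ (opposite h) <_) (opposite-last ℓ-last) (h′<T′ (∈-reverse⁺ ℓ∈T)))
class-mirror-disjoint {d = d} 0<d (inj₂ (_ , ℓ , ℓ∈T , ℓ-last)) (inj₂ (T′≥d , _)) =
  <⇒≱ 0<d (subst (d ≤_) (opposite-last ℓ-last) (T′≥d (∈-reverse⁺ ℓ∈T)))

lift-class : ∀ {d} {x : Pair n} → Class d x → Class (suc d) (lift x)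
lift-class (inj₁ (h<d , h<T , t , t∈T)) =
  inj₁ (s≤s h<d , (λ { (there p) → s≤s (h<T p) }) , suc t , there t∈T)
lift-class (inj₂ (T≥d , ℓ , ℓ∈T , ℓ-last)) =
  inj₂ ((λ { (there p) → s≤s (T≥d p) }) , suc ℓ , there ℓ∈T , cong suc ℓ-last)

apex-class : ∀ {d} {T : Subset n} → Nonempty T → Class (suc d) (apex T)
apex-class (t , t∈T) = inj₁ (s≤s z≤n , (λ { (there _) → s≤s z≤n }) , suc t , there t∈T)

nonempty : ∀ {k} (T : Subset n) → ∣ T ∣ ≡ suc k → Nonempty T
nonempty (inside  ∷ T) _ = zero , here
nonempty (outside ∷ T) ∣T∣≡1+k with nonempty T ∣T∣≡1+k
... | t , t∈T = suc t , there t∈T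

-- The construction, for sets of size r = k + 1 and a core of m + 1 points.
module Construction (k m : ℕ) where

  r : ℕ
  r = suc k

  -- Anchored core: mirror images of the vertices of H_{m+1:r} containing 0 in
  -- their set, i.e. the vertices of H_{m+1:r} whose set contains the last point.
  core : List (Pair (suc m))
  core = map (mirror ∘ liftWith0) (vertices m k)

  -- family d lives on d new points followed by the core.
  family : (d : ℕ) → List (Pair (d + suc m))
  family zero    = core
  family (suc d) = map apex (subsets (d + suc m) r) ++ map lift (family d)

  core-member : ∀ {x} → IsVertex m k x → IsVertex (suc m) r (mirror (liftWith0 x)) × Class 0 (mirror (liftWith0 x))
  core-member {h , T} x-vertex =
    mirror-vertex (liftWith0-vertex x-vertex) ,
    inj₂ ((λ _ → z≤n) , opposite zero , ∈-reverse⁺ {T = inside ∷ T} here , cong suc (toℕ-fromℕ m))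

  family-members : ∀ d → All (λ x → IsVertex (d + suc m) r x × Class d x) (family d)
  family-members zero    = map⁺ (All.map core-member (vertices-vertex m k))
  family-members (suc d) =
    All-++⁺ (map⁺ (All.map (λ ∣T∣≡r → apex-vertex ∣T∣≡r , apex-class (nonempty _ ∣T∣≡r)) (subsets-size (d + suc m) r)))
            (map⁺ (All.map (λ (x-vertex , x-class) → lift-vertex x-vertex , lift-class x-class) (family-members d)))

  -- New vertices have head 0, lifted old ones do not.
  family-unique : ∀ d → Unique (family d)
  family-unique zero    = Unique.map⁺ (liftWith0-injective ∘ mirror-injective) (vertices-unique m k)
  family-unique (suc d) =
    unique-++ HeadIsZero (Unique.map⁺ apex-injective (subsets-unique (d + suc m) r)) (Unique.map⁺ lift-injective (family-unique d))
      (all-images apex (λ _ → refl) (subsets (d + suc m) r)) (all-images lift (λ _ ()) (family d))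

  family-independent : ∀ d → IsIndependent (d + suc m) r (family d)
  family-independent d =
    (family-unique d , proj₁ ∘ All.lookup (family-members d)) ,
    λ x∈ y∈ → class-independent (proj₂ (All.lookup (family-members d) x∈)) (proj₂ (All.lookup (family-members d) y∈))

  family-mirror-disjoint : ∀ d → Disjoint (family (suc d)) (map mirror (family (suc d)))
  family-mirror-disjoint d x∈ x∈mirror with ∈-map⁻ mirror x∈mirror
  ... | x₀ , x₀∈ , refl =
    class-mirror-disjoint (s≤s z≤n) (proj₂ (All.lookup (family-members (suc d)) x₀∈)) (proj₂ (All.lookup (family-members (suc d)) x∈))

  core-length : length core ≡ r * (m C r)
  core-length = trans (length-map (mirror ∘ liftWith0) (vertices m k)) (vertices-length m k)

  -- Each new point adds C(N, r) vertices, so by Pascal's rule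
  -- |family d| + C(m+1, r+1) = C(d+m+1, r+1) + |core|.
  family-growth : ∀ d → length (family d) + suc m C suc r ≡ (d + suc m) C suc r + length core
  family-growth zero    = +-comm (length core) (suc m C suc r)
  family-growth (suc d) = begin
    length (map apex (subsets N r) ++ map lift (family d)) + suc m C suc r
      ≡⟨ cong (_+ suc m C suc r) (length-map-++ apex lift (subsets N r) (family d)) ⟩
    length (subsets N r) + length (family d) + suc m C suc r
      ≡⟨ shift (length (subsets N r)) (length (family d)) (suc m C suc r) ⟩
    length (subsets N r) + (length (family d) + suc m C suc r)
      ≡⟨ cong₂ _+_ (subsets-length N r) (family-growth d) ⟩
    N C r + (N C suc r + length core)
      ≡⟨ shift (N C r) (N C suc r) (length core) ⟨
    N C r + N C suc r + length core
      ≡⟨ cong (_+ length core) (pascal N r) ⟨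
    suc N C suc r + length core ∎
    where
    N = d + suc m
    shift : ∀ a b c → a + b + c ≡ a + (b + c)
    shift = solve-∀

  family-length : m ≡ k * k + 2 * k → ∀ d →
    suc r * length (family d) ≡ suc r * ((d + suc m) C suc r) + k * (suc m C r)
  family-length m≡ d = +-cancelʳ-≡ (suc r * c) _ _ (begin
    suc r * length (family d) + suc r * c
      ≡⟨ *-distribˡ-+ (suc r) (length (family d)) c ⟨
    suc r * (length (family d) + c)
      ≡⟨ cong (suc r *_) (family-growth d) ⟩
    suc r * (N + length core)
      ≡⟨ cong (λ l → suc r * (N + l)) core-length ⟩
    suc r * (N + r * (m C r))
      ≡⟨ *-distribˡ-+ (suc r) N (r * (m C r)) ⟩
    suc r * N + suc r * (r * (m C r))
      ≡⟨ cong (suc r * N +_) (core-identity m≡) ⟩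
    suc r * N + (suc r * c + k * (suc m C r))
      ≡⟨ swap (suc r * N) (suc r * c) (k * (suc m C r)) ⟩
    suc r * N + k * (suc m C r) + suc r * c ∎)
    where
    c = suc m C suc r
    N = (d + suc m) C suc r
    swap : ∀ a b c → a + (b + c) ≡ a + c + b
    swap = solve-∀

TwoDisjointIndependentSets : ℕ → ℕ → Set
TwoDisjointIndependentSets r n = ∃₂ λ (I J : List (Fin n × Subset n)) →
  IsIndependent n r I × IsIndependent n r J × Disjoint I J ×
  ((r + 1) * length I ≡ (r + 1) * (n C (r + 1)) + (r ∸ 1) * ((r ^ 2) C r)) ×
  ((r + 1) * length J ≡ (r + 1) * (n C (r + 1)) + (r ∸ 1) * ((r ^ 2) C r))

-- The core has (k+1)² = m + 1 points with m = k² + 2k.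
square : ∀ k → suc k ^ 2 ≡ suc (k * k + 2 * k)
square k = expand k
  where
  expand : ∀ k → suc k * (suc k * 1) ≡ suc (k * k + 2 * k)
  expand = solve-∀

two-disjoint-independent-sets : ∀ k o → TwoDisjointIndependentSets (suc k) (suc o + suc k ^ 2)
two-disjoint-independent-sets k o =
  I , map mirror I , family-independent (suc o) , mirror-independent (family-independent (suc o)) ,
  family-mirror-disjoint o , size-I , trans (cong ((suc k + 1) *_) (length-map mirror I)) size-I
  where
  open Construction k (pred (suc k ^ 2))
  I = family (suc o)
  size-I : (suc k + 1) * length I ≡ (suc k + 1) * ((suc o + suc k ^ 2) C (suc k + 1)) + k * (suc k ^ 2 C suc k)
  size-I = subst (λ s → s * length I ≡ s * ((suc o + suc k ^ 2) C s) + k * (suc k ^ 2 C suc k))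
                 (+-comm 1 (suc k)) (family-length (suc-injective (square k)) (suc o))

mainTheorem13 : (r n : ℕ) → 2 ≤ r → r ^ 2 + 1 ≤ n →
    ∃₂ λ (I J : List (Fin n × Subset n)) →
      IsIndependent n r I × IsIndependent n r J × Disjoint I J ×
      ((r + 1) * length I ≡ (r + 1) * (n C (r + 1)) + (r ∸ 1) * ((r ^ 2) C r)) ×
      ((r + 1) * length J ≡ (r + 1) * (n C (r + 1)) + (r ∸ 1) * ((r ^ 2) C r))
mainTheorem13 zero    _ () _
mainTheorem13 (suc k) n _ r²+1≤n with m≤n⇒∃[o]m+o≡n r²+1≤n
... | o , r²+1+o≡n =
  subst (TwoDisjointIndependentSets (suc k)) (trans (reorder (suc k ^ 2) o) r²+1+o≡n) (two-disjoint-independent-sets k o)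
  where
  reorder : ∀ s o → suc o + s ≡ s + 1 + o
  reorder = solve-∀
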